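{- Let $G$ be a graph with degree sequence $(d_1,\ldots,d_n)$, where $d_1\ge d_2\ge\cdots\ge d_n$, and let $\Sigma$ be a signed graph with underlying graph $G$. Then $$l(\Sigma)\le \sum_{i=1}^{l_0(\Sigma)} \left\lfloor \frac{d_i}{2}\right\rfloor.$$
   Context: A signed graph $\Sigma=(G,\sigma)$ consists of a graph $G$ and a sign function $\sigma: E(G)\to\{+1,-1\}$. A circle is a connected nonempty 2-regular subgraph; it is positive if the product of the signs of its edges is $+1$ and negative otherwise. $\Sigma$ is balanced if every circle is positive. The frustration index $l(\Sigma)$ is the smallest number of edges whose deletion from $\Sigma$ leaves a balanced signed graph; the frustration number $l_0(\Sigma)$ is the smallest number of vertices whose deletion from $\Sigma$ leaves a balanced signed graph. -}

module Defs where

open import Data.Bool using (Bool; true; false; if_then_else_; _∧_; not)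
open import Data.Nat using (ℕ; zero; suc; _+_; _≤_; _<_; ⌊_/2⌋; _<ᵇ_)
open import Data.Fin using (Fin; toℕ) renaming (zero to fzero; suc to fsuc; _≤_ to _≤ᶠ_)
open import Data.Fin.Properties using (_≟_)
open import Data.Fin.Subset using (Subset; _∈_; _⊆_; ∣_∣; Nonempty; ∁)
open import Data.Fin.Subset.Properties using (_∈?_)
open import Data.Vec using (tabulate)
open import Data.Product using (_×_; _,_; proj₁; proj₂; Σ; swap)
open import Data.Sum using (_⊎_)
open import Relation.Binary.PropositionalEquality using (_≡_; _≢_)
open import Relation.Nullary using (Dec; ¬_)
open import Relation.Nullary.Decidable using (⌊_⌋; _⊎-dec_)

sumFin : ∀ {m} → (Fin m → ℕ) → ℕ
sumFin {zero}  f = 0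
sumFin {suc m} f = f fzero + sumFin (λ i → f (fsuc i))

countWhere : ∀ {m} → (Fin m → Bool) → ℕ
countWhere f = sumFin (λ i → if f i then 1 else 0)

SameEnds : ∀ {n} → Fin n × Fin n → Fin n × Fin n → Set
SameEnds p q = (p ≡ q) ⊎ (p ≡ swap q)

record Graph (n : ℕ) : Set where
  field
    m          : ℕ
    ends       : Fin m → Fin n × Fin n
    loopless   : ∀ e → proj₁ (ends e) ≢ proj₂ (ends e)
    noParallel : ∀ e f → SameEnds (ends e) (ends f) → e ≡ f

module _ {n : ℕ} (G : Graph n) where
  open Graph G

  Incident : Fin m → Fin n → Set
  Incident e v = (proj₁ (ends e) ≡ v) ⊎ (proj₂ (ends e) ≡ v)

  incident? : ∀ e v → Dec (Incident e v)
  incident? e v = (proj₁ (ends e) ≟ v) ⊎-dec (proj₂ (ends e) ≟ v)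

  degIn : Subset m → Fin n → ℕ
  degIn S v = countWhere (λ e → ⌊ e ∈? S ⌋ ∧ ⌊ incident? e v ⌋)

  degree : Fin n → ℕ
  degree v = countWhere (λ e → ⌊ incident? e v ⌋)

  Joins : Fin m → Fin n → Fin n → Set
  Joins e u w = SameEnds (ends e) (u , w)

  data Reach (S : Subset m) : Fin n → Fin n → Set where
    here : ∀ {u} → Reach S u u
    step : ∀ {u w v} (e : Fin m) → e ∈ S → Joins e u w → Reach S w v → Reach S u v

  -- The subgraph with edge set S (and vertex set the vertices incident with S)
  -- is a circle: nonempty, 2-regular, connected.
  IsCircle : Subset m → Set
  IsCircle S =
    Nonempty S
    × (∀ v → (degIn S v ≡ 0) ⊎ (degIn S v ≡ 2))
    × (∀ u v → 0 < degIn S u → 0 < degIn S v → Reach S u v)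

  -- edges with no endpoint in the vertex set X (the edges of G - X)
  edgesAvoiding : Subset n → Subset m
  edgesAvoiding X =
    tabulate (λ e → not ⌊ proj₁ (ends e) ∈? X ⌋ ∧ not ⌊ proj₂ (ends e) ∈? X ⌋)

data Sign : Set where
  plus minus : Sign

_·_ : Sign → Sign → Sign
plus  · s = s
minus · plus = minus
minus · minus = plus

signProd : ∀ {m} → (Fin m → Sign) → Subset m → Sign
signProd {zero}  σ S = plus
signProd {suc m} σ (true  Data.Vec.∷ S) = σ fzero · signProd (λ i → σ (fsuc i)) S
signProd {suc m} σ (false Data.Vec.∷ S) = signProd (λ i → σ (fsuc i)) S

module _ {n : ℕ} (G : Graph n) (σ : Fin (Graph.m G) → Sign) where
  open Graph G

  BalancedOn : Subset m → Set
  BalancedOn K = ∀ S → S ⊆ K → IsCircle G S → signProd σ S ≡ plus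

  BalancedAfterEdgeDeletion : Subset m → Set
  BalancedAfterEdgeDeletion D = BalancedOn (∁ D)

  BalancedAfterVertexDeletion : Subset n → Set
  BalancedAfterVertexDeletion X = BalancedOn (edgesAvoiding G X)

  IsFrustrationIndex : ℕ → Set
  IsFrustrationIndex l =
    Σ (Subset m) (λ D → ∣ D ∣ ≡ l × BalancedAfterEdgeDeletion D)
    × (∀ D → BalancedAfterEdgeDeletion D → l ≤ ∣ D ∣)

  IsFrustrationNumber : ℕ → Set
  IsFrustrationNumber l₀ =
    Σ (Subset n) (λ X → ∣ X ∣ ≡ l₀ × BalancedAfterVertexDeletion X)
    × (∀ X → BalancedAfterVertexDeletion X → l₀ ≤ ∣ X ∣)

module _ {n : ℕ} (G : Graph n) where
  -- π lists the vertices in order of non-increasing degree: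
  -- d_i = degree (π i), d_1 ≥ d_2 ≥ ... ≥ d_n
  DegreeSorted : (Fin n → Fin n) → Set
  DegreeSorted π = ∀ i j → i ≤ᶠ j → degree G (π j) ≤ degree G (π i)

  topHalfDegreeSum : (Fin n → Fin n) → ℕ → ℕ
  topHalfDegreeSum π k = sumFin (λ i → if toℕ i <ᵇ k then ⌊ degree G (π i) /2⌋ else 0)

-- Harary: a signed graph is balanced iff some switching τ makes every edge positive.
-- Applied to Σ − X, where ∣X∣ = l₀(Σ) and Σ − X is balanced, this gives τ under which
-- every edge avoiding X is positive.  While some x ∈ X has more than half of its edges
-- negative, switch at x: edges avoiding X stay positive and the number of negative edges
-- drops.  Then every negative edge meets X and each x ∈ X meets at most ⌊d(x)/2⌋ of them,
-- and deleting the negative edges balances Σ; hence l(Σ) ≤ ∑_{x∈X} ⌊d(x)/2⌋, which is at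
-- most the sum of the l₀ largest values ⌊dᵢ/2⌋.
-- Harary's theorem is proved by adding the edges of a balanced edge set one at a time,
-- keeping track of components and simple paths inside them: an edge inside a component
-- closes a circle, and the sign of a circle is invariant under switching.

module Submission where

open import Defs
open import Level using (0ℓ)
open import Algebra.Bundles using (CommutativeMonoid)
import Algebra.Properties.CommutativeMonoid.Sum as Sum
import Algebra.Properties.Monoid.Mult as Mult
import Algebra.Solver.CommutativeMonoid as CMSolver
open import Data.Bool using (Bool; true; false; if_then_else_; _∧_; _∨_; not; _xor_)
open import Data.Nat using (ℕ; zero; suc; _+_; _≤_; _<_; _<?_; _<ᵇ_; ⌊_/2⌋; z≤n; s≤s)
open import Data.Nat.Solver using (module +-*-Solver)
open import Data.Nat.Properties
  using ( +-0-commutativeMonoid; +-identityʳ; +-comm; +-mono-≤; +-monoʳ-≤; +-monoʳ-<; +-cancelʳ-<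
        ; ≤-refl; ≤-trans; ≤-reflexive; ≤-pred; <-irrefl; <⇒≤; <-≤-trans; ≮⇒≥; n<1+n; m<n⇒m<1+n
        ; m≤n⇒m<n∨m≡n; m≤m+n; m≤n+m; ⌊n/2⌋-mono; n≡⌊n+n/2⌋; module ≤-Reasoning )
open import Data.Fin using (Fin; toℕ; fromℕ<) renaming (zero to fzero; suc to fsuc)
open import Data.Fin.Properties using (_≟_; any?; toℕ<n; toℕ-fromℕ<; toℕ-injective)
open import Data.Fin.Subset using (Subset; _∈_; _∉_; _⊆_; ∣_∣)
open import Data.Fin.Subset.Properties using (_∈?_; x∈∁p⇒x∉p)
open import Data.Vec using ([]; _∷_; lookup; tabulate; here; there)
open import Data.Vec.Properties using (lookup∘tabulate; []=⇒lookup; lookup⇒[]=)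
open import Data.List using (List; []; _∷_; _++_; map)
open import Data.Nat.ListAction using (sum)
open import Data.List.Membership.Propositional using () renaming (_∈_ to _∈ₗ_)
open import Data.List.Relation.Unary.All as All using (All; []; _∷_)
import Data.List.Relation.Unary.All.Properties as All
open import Data.List.Relation.Unary.All.Properties using (All¬⇒¬Any; ¬Any⇒All¬)
open import Data.List.Relation.Unary.Any as Any using (here; there)
open import Data.List.Relation.Unary.Unique.Propositional using (Unique)
import Data.List.Relation.Unary.Unique.Propositional.Properties as Unique
open import Data.List.Relation.Binary.Disjoint.Propositional using (Disjoint)
open import Data.List.Relation.Unary.AllPairs using ([]; _∷_)
open import Data.Product using (_×_; _,_; proj₁; proj₂; Σ; ∃)
open import Data.Sum using (_⊎_; inj₁; inj₂)
open import Data.Empty using (⊥-elim)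
open import Function.Base using (_∘_)
open import Relation.Binary.PropositionalEquality as ≡
  using (_≡_; _≢_; refl; cong; cong₂; subst; module ≡-Reasoning)
open import Relation.Nullary using (Dec; does; proof; yes; no; ¬_)
open import Relation.Nullary.Reflects using (Reflects; invert)
open import Relation.Nullary.Decidable using (⌊_⌋; _×-dec_; isYes≗does; dec-true; dec-false)
open import Function.Bundles using (_↔_; Inverse)

·-assoc : ∀ a b c → (a · b) · c ≡ a · (b · c)
·-assoc plus  b     c = refl
·-assoc minus plus  c = refl
·-assoc minus minus plus  = refl
·-assoc minus minus minus = refl

·-comm : ∀ a b → a · b ≡ b · a
·-comm plus  plus  = refl
·-comm plus  minus = refl
·-comm minus plus  = refl
·-comm minus minus = refl

·-identityʳ : ∀ a → a · plus ≡ a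
·-identityʳ plus  = refl
·-identityʳ minus = refl

·-selfInverse : ∀ a → a · a ≡ plus
·-selfInverse plus  = refl
·-selfInverse minus = refl

·-commutativeMonoid : CommutativeMonoid 0ℓ 0ℓ
·-commutativeMonoid = record
  { Carrier = Sign ; _≈_ = _≡_ ; _∙_ = _·_ ; ε = plus
  ; isCommutativeMonoid = record
    { isMonoid = record
      { isSemigroup = record
        { isMagma = record { isEquivalence = ≡.isEquivalence ; ∙-cong = cong₂ _·_ }
        ; assoc = ·-assoc }
      ; identity = (λ _ → refl) , ·-identityʳ }
    ; comm = ·-comm } }

isMinus : Sign → Bool
isMinus plus  = false
isMinus minus = true

isMinus≡false : ∀ {a} → isMinus a ≡ false → a ≡ plus
isMinus≡false {plus} _ = refl

isMinus-· : ∀ a b → isMinus (a · b) ≡ isMinus a xor isMinus b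
isMinus-· plus  b     = refl
isMinus-· minus plus  = refl
isMinus-· minus minus = refl

·-interchange : ∀ a b c d → (a · b) · (c · d) ≡ (a · c) · (b · d)
·-interchange = solve 4 (λ a b c d → (a ⊕ b) ⊕ (c ⊕ d) ⊜ (a ⊕ c) ⊕ (b ⊕ d)) refl
  where open CMSolver ·-commutativeMonoid

open Mult (CommutativeMonoid.monoid ·-commutativeMonoid) using () renaming (_×_ to _×ₛ_)

module ℕΣ = Sum +-0-commutativeMonoid
module SignΣ = Sum ·-commutativeMonoid

≟-comm : ∀ {k} (a b : Fin k) → does (a ≟ b) ≡ does (b ≟ a)
≟-comm a b with a ≟ b | b ≟ a
... | yes _  | yes _ = refl
... | no _   | no _  = refl
... | yes a≡b | no b≢a = ⊥-elim (b≢a (≡.sym a≡b))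
... | no a≢b  | yes b≡a = ⊥-elim (a≢b (≡.sym b≡a))

module _ {c ℓ} (M : CommutativeMonoid c ℓ) where
  open CommutativeMonoid M
    using (_≈_; _∙_; ε; setoid; sym; trans; ∙-cong; ∙-congˡ; identityˡ; identityʳ; monoid)
    renaming (Carrier to C; refl to ≈-refl)
  open Sum M using (sum-replicate-zero; ∑-distrib-+; sum-cong-≋) renaming (sum to ∑)
  open Mult monoid using () renaming (_×_ to _×′_)

  sum-pick : ∀ {k} (a : Fin k) (t : Fin k → C) → ∑ (λ i → if does (i ≟ a) then t i else ε) ≈ t a
  sum-pick {suc k} fzero    t = trans (∙-congˡ (sum-replicate-zero k)) (identityʳ _)
  sum-pick {suc k} (fsuc a) t = trans (identityˡ _) (sum-pick a (t ∘ fsuc))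

  sum-pickPair : ∀ {k} {a b : Fin k} → a ≢ b → (t : Fin k → C) →
                 ∑ (λ i → if does (i ≟ a) ∨ does (i ≟ b) then t i else ε) ≈ t a ∙ t b
  sum-pickPair {k} {a} {b} a≢b t = begin
    ∑ (λ i → if does (i ≟ a) ∨ does (i ≟ b) then t i else ε) ≈⟨ sum-cong-≋ split ⟩
    ∑ (λ i → at a i ∙ at b i)                                 ≈⟨ ∑-distrib-+ (at a) (at b) ⟩
    ∑ (at a) ∙ ∑ (at b)                                       ≈⟨ ∙-cong (sum-pick a t) (sum-pick b t) ⟩
    t a ∙ t b                                                   ∎
    where
      open import Relation.Binary.Reasoning.Setoid setoid
      at : Fin k → Fin k → C
      at x i = if does (i ≟ x) then t i else ε
      split : ∀ i → (if does (i ≟ a) ∨ does (i ≟ b) then t i else ε) ≈ at a i ∙ at b i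
      split i with i ≟ a | i ≟ b
      ... | yes refl | yes refl = ⊥-elim (a≢b refl)
      ... | yes _    | no _     = sym (identityʳ _)
      ... | no _     | yes _    = sym (identityˡ _)
      ... | no _     | no _     = sym (identityˡ _)

  sum-countWhere : ∀ {k} (b : Fin k → Bool) (x : C) → ∑ (λ i → if b i then x else ε) ≈ countWhere b ×′ x
  sum-countWhere {zero}  b x = ≈-refl
  sum-countWhere {suc k} b x with b fzero
  ... | true  = ∙-congˡ (sum-countWhere (b ∘ fsuc) x)
  ... | false = trans (identityˡ _) (sum-countWhere (b ∘ fsuc) x)

_∈ₗ?_ : ∀ {k} (i : Fin k) (L : List (Fin k)) → Dec (i ∈ₗ L)
i ∈ₗ? L = Any.any? (i ≟_) L

𝟙 : Bool → ℕ
𝟙 b = if b then 1 else 0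

sumFin≡sum : ∀ {k} (f : Fin k → ℕ) → sumFin f ≡ ℕΣ.sum f
sumFin≡sum {zero}  f = refl
sumFin≡sum {suc k} f = cong (f fzero +_) (sumFin≡sum (f ∘ fsuc))

sumFin-cong : ∀ {k} {f g : Fin k → ℕ} → (∀ i → f i ≡ g i) → sumFin f ≡ sumFin g
sumFin-cong {zero}  f≗g = refl
sumFin-cong {suc k} f≗g = cong₂ _+_ (f≗g fzero) (sumFin-cong (f≗g ∘ fsuc))

sumFin-mono : ∀ {k} {f g : Fin k → ℕ} → (∀ i → f i ≤ g i) → sumFin f ≤ sumFin g
sumFin-mono {zero}  f≤g = z≤n
sumFin-mono {suc k} f≤g = +-mono-≤ (f≤g fzero) (sumFin-mono (f≤g ∘ fsuc))

term≤sumFin : ∀ {k} (f : Fin k → ℕ) (a : Fin k) → f a ≤ sumFin f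
term≤sumFin f fzero    = m≤m+n (f fzero) _
term≤sumFin f (fsuc a) = ≤-trans (term≤sumFin (f ∘ fsuc) a) (m≤n+m _ (f fzero))

sumFin-zero : ∀ k → sumFin {k} (λ _ → 0) ≡ 0
sumFin-zero zero    = refl
sumFin-zero (suc k) = sumFin-zero k

sumFin-+ : ∀ {k} (f g : Fin k → ℕ) → sumFin (λ i → f i + g i) ≡ sumFin f + sumFin g
sumFin-+ f g = begin
  sumFin (λ i → f i + g i)    ≡⟨ sumFin≡sum (λ i → f i + g i) ⟩
  ℕΣ.sum (λ i → f i + g i)    ≡⟨ ℕΣ.∑-distrib-+ f g ⟩
  ℕΣ.sum f + ℕΣ.sum g         ≡⟨ cong₂ _+_ (sumFin≡sum f) (sumFin≡sum g) ⟨
  sumFin f + sumFin g         ∎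
  where open ≡-Reasoning

sumFin-comm : ∀ {a b} (f : Fin a → Fin b → ℕ) →
              sumFin (λ i → sumFin (f i)) ≡ sumFin (λ j → sumFin (λ i → f i j))
sumFin-comm f = begin
  sumFin (λ i → sumFin (f i))                ≡⟨ sumFin≡sum (λ i → sumFin (f i)) ⟩
  ℕΣ.sum (λ i → sumFin (f i))                ≡⟨ ℕΣ.sum-cong-≗ (sumFin≡sum ∘ f) ⟩
  ℕΣ.sum (λ i → ℕΣ.sum (f i))                ≡⟨ ℕΣ.∑-comm f ⟩
  ℕΣ.sum (λ j → ℕΣ.sum (λ i → f i j))        ≡⟨ ℕΣ.sum-cong-≗ (λ j → sumFin≡sum (λ i → f i j)) ⟨
  ℕΣ.sum (λ j → sumFin (λ i → f i j))        ≡⟨ sumFin≡sum (λ j → sumFin (λ i → f i j)) ⟨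
  sumFin (λ j → sumFin (λ i → f i j))        ∎
  where open ≡-Reasoning

sumFin-permute : ∀ {k} (f : Fin k → ℕ) (π : Fin k ↔ Fin k) → sumFin f ≡ sumFin (f ∘ Inverse.to π)
sumFin-permute f π = begin
  sumFin f                       ≡⟨ sumFin≡sum f ⟩
  ℕΣ.sum f                       ≡⟨ ℕΣ.sum-permute f π ⟩
  ℕΣ.sum (f ∘ Inverse.to π)      ≡⟨ sumFin≡sum (f ∘ Inverse.to π) ⟨
  sumFin (f ∘ Inverse.to π)      ∎
  where open ≡-Reasoning

sumFin-∈-Unique : ∀ {k} {L : List (Fin k)} → Unique L → (f : Fin k → ℕ) →
                  sumFin (λ i → if does (i ∈ₗ? L) then f i else 0) ≡ sum (map f L)
sumFin-∈-Unique {k} {[]}    _            f = sumFin-zero k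
sumFin-∈-Unique {k} {x ∷ L} (x∉L ∷ uniq) f = begin
  sumFin (λ i → if does (i ≟ x) ∨ does (i ∈ₗ? L) then f i else 0)
    ≡⟨ sumFin-cong split ⟩
  sumFin (λ i → (if does (i ≟ x) then f i else 0) + (if does (i ∈ₗ? L) then f i else 0))
    ≡⟨ sumFin-+ atx inL ⟩
  sumFin atx + sumFin inL
    ≡⟨ cong₂ _+_ (≡.trans (sumFin≡sum atx) (sum-pick +-0-commutativeMonoid x f)) (sumFin-∈-Unique uniq f) ⟩
  f x + sum (map f L)
    ∎
  where
    open ≡-Reasoning
    atx inL : Fin k → ℕ
    atx i = if does (i ≟ x) then f i else 0
    inL i = if does (i ∈ₗ? L) then f i else 0
    split : ∀ i → (if does (i ≟ x) ∨ does (i ∈ₗ? L) then f i else 0)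
                  ≡ (if does (i ≟ x) then f i else 0) + (if does (i ∈ₗ? L) then f i else 0)
    split i with i ≟ x
    ... | yes refl rewrite dec-false (i ∈ₗ? L) (All¬⇒¬Any x∉L) = ≡.sym (+-identityʳ (f i))
    ... | no _ = refl

countWhere-∧ˡ : ∀ {k} (b : Bool) (c : Fin k → Bool) →
                countWhere (λ i → b ∧ c i) ≡ (if b then countWhere c else 0)
countWhere-∧ˡ {k} true  c = refl
countWhere-∧ˡ {k} false c = sumFin-zero k

𝟙-xor : ∀ b c → 𝟙 (b xor c) + (𝟙 (b ∧ c) + 𝟙 (b ∧ c)) ≡ 𝟙 b + 𝟙 c
𝟙-xor true  true  = refl
𝟙-xor true  false = refl
𝟙-xor false true  = refl
𝟙-xor false false = refl

countWhere-xor : ∀ {k} (b c : Fin k → Bool) →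
                 countWhere (λ i → b i xor c i)
                   + (countWhere (λ i → b i ∧ c i) + countWhere (λ i → b i ∧ c i))
                 ≡ countWhere b + countWhere c
countWhere-xor {k} b c = begin
  countWhere (λ i → b i xor c i) + (countWhere b∧c + countWhere b∧c)
    ≡⟨ cong (countWhere (λ i → b i xor c i) +_) (sumFin-+ (𝟙 ∘ b∧c) (𝟙 ∘ b∧c)) ⟨
  countWhere (λ i → b i xor c i) + sumFin (λ i → 𝟙 (b∧c i) + 𝟙 (b∧c i))
    ≡⟨ sumFin-+ (λ i → 𝟙 (b i xor c i)) (λ i → 𝟙 (b∧c i) + 𝟙 (b∧c i)) ⟨
  sumFin (λ i → 𝟙 (b i xor c i) + (𝟙 (b∧c i) + 𝟙 (b∧c i)))
    ≡⟨ sumFin-cong (λ i → 𝟙-xor (b i) (c i)) ⟩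
  sumFin (λ i → 𝟙 (b i) + 𝟙 (c i))
    ≡⟨ sumFin-+ (𝟙 ∘ b) (𝟙 ∘ c) ⟩
  countWhere b + countWhere c
    ∎
  where
    open ≡-Reasoning
    b∧c : Fin k → Bool
    b∧c i = b i ∧ c i

∈?-lookup : ∀ {k} (i : Fin k) (p : Subset k) → does (i ∈? p) ≡ lookup p i
∈?-lookup fzero    (true  ∷ p) = refl
∈?-lookup fzero    (false ∷ p) = refl
∈?-lookup (fsuc i) (_ ∷ p)     = ∈?-lookup i p

∣p∣≡countWhere-∈ : ∀ {k} (p : Subset k) → ∣ p ∣ ≡ countWhere (λ i → does (i ∈? p))
∣p∣≡countWhere-∈ []          = refl
∣p∣≡countWhere-∈ (true  ∷ p) = cong suc (∣p∣≡countWhere-∈ p)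
∣p∣≡countWhere-∈ (false ∷ p) = ∣p∣≡countWhere-∈ p

∈-tabulate⁻ : ∀ {k} {b : Fin k → Bool} {i} → i ∈ tabulate b → b i ≡ true
∈-tabulate⁻ {b = b} {i} i∈ = ≡.trans (≡.sym (lookup∘tabulate b i)) ([]=⇒lookup i∈)

∈-tabulate⁺ : ∀ {k} {b : Fin k → Bool} {i} → b i ≡ true → i ∈ tabulate b
∈-tabulate⁺ {b = b} {i} bi = lookup⇒[]= i (tabulate b) (≡.trans (lookup∘tabulate b i) bi)

∉-tabulate⁻ : ∀ {k} {b : Fin k → Bool} {i} → i ∉ tabulate b → b i ≡ false
∉-tabulate⁻ {b = b} {i} i∉ with b i in bi
... | true  = ⊥-elim (i∉ (∈-tabulate⁺ bi))
... | false = refl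

does-∈?-tabulate : ∀ {k} (b : Fin k → Bool) i → does (i ∈? tabulate b) ≡ b i
does-∈?-tabulate b i = ≡.trans (∈?-lookup i (tabulate b)) (lookup∘tabulate b i)

∣tabulate∣ : ∀ {k} (b : Fin k → Bool) → ∣ tabulate b ∣ ≡ countWhere b
∣tabulate∣ b = ≡.trans (∣p∣≡countWhere-∈ (tabulate b)) (sumFin-cong (cong 𝟙 ∘ does-∈?-tabulate b))

𝟙-≟-distinct : ∀ {k} {a b : Fin k} → a ≢ b → ∀ w →
                𝟙 (does (w ≟ a) ∨ does (w ≟ b)) ≡ 𝟙 (does (w ≟ a)) + 𝟙 (does (w ≟ b))
𝟙-≟-distinct {a = a} {b} a≢b w with w ≟ a | w ≟ b
... | yes refl | yes refl = ⊥-elim (a≢b refl)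
... | yes _    | no _     = refl
... | no _     | _        = refl

module Incidence {n : ℕ} (G : Graph n) where
  open Graph G

  end₁ end₂ : Fin m → Fin n
  end₁ e = proj₁ (ends e)
  end₂ e = proj₂ (ends e)

  incident-does : ∀ e v → does (incident? G e v) ≡ does (v ≟ end₁ e) ∨ does (v ≟ end₂ e)
  incident-does e v = cong₂ _∨_ (≟-comm (end₁ e) v) (≟-comm (end₂ e) v)

  degIn-does : ∀ S v → degIn G S v ≡ countWhere (λ e → does (e ∈? S) ∧ does (incident? G e v))
  degIn-does S v = sumFin-cong λ e → cong 𝟙 (cong₂ _∧_ (isYes≗does (e ∈? S)) (isYes≗does (incident? G e v)))

  degree-does : ∀ v → degree G v ≡ countWhere (λ e → does (incident? G e v))
  degree-does v = sumFin-cong λ e → cong 𝟙 (isYes≗does (incident? G e v))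

  𝟙-incident : ∀ {e a b} → Joins G e a b → ∀ w →
               𝟙 (does (incident? G e w)) ≡ 𝟙 (does (w ≟ a)) + 𝟙 (does (w ≟ b))
  𝟙-incident {e} (inj₁ refl) w =
    ≡.trans (cong 𝟙 (incident-does e w)) (𝟙-≟-distinct (loopless e) w)
  𝟙-incident {e} (inj₂ refl) w =
    ≡.trans (cong 𝟙 (incident-does e w))
            (≡.trans (𝟙-≟-distinct (loopless e) w) (+-comm (𝟙 (does (w ≟ end₁ e))) _))

  EvenDegrees : Subset m → Set
  EvenDegrees S = ∀ v → ∃ λ k → degIn G S v ≡ k + k

  isCircle⇒evenDegrees : ∀ {S} → IsCircle G S → EvenDegrees S
  isCircle⇒evenDegrees (_ , deg , _) v with deg v
  ... | inj₁ d≡0 = 0 , d≡0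
  ... | inj₂ d≡2 = 1 , d≡2

PositiveOn : ∀ {k} → (Fin k → Sign) → Subset k → Set
PositiveOn f S = ∀ {e} → e ∈ S → f e ≡ plus

signProd≡∑ : ∀ {k} (f : Fin k → Sign) (S : Subset k) →
             signProd f S ≡ SignΣ.sum (λ e → if does (e ∈? S) then f e else plus)
signProd≡∑ {zero}  f []          = refl
signProd≡∑ {suc k} f (true  ∷ S) = cong (f fzero ·_) (signProd≡∑ (f ∘ fsuc) S)
signProd≡∑ {suc k} f (false ∷ S) = signProd≡∑ (f ∘ fsuc) S

signProd-· : ∀ {k} (f g : Fin k → Sign) (S : Subset k) →
             signProd (λ e → f e · g e) S ≡ signProd f S · signProd g S
signProd-· {zero}  f g []          = refl
signProd-· {suc k} f g (true  ∷ S) =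
  ≡.trans (cong ((f fzero · g fzero) ·_) (signProd-· (f ∘ fsuc) (g ∘ fsuc) S))
          (·-interchange (f fzero) (g fzero) _ _)
signProd-· {suc k} f g (false ∷ S) = signProd-· (f ∘ fsuc) (g ∘ fsuc) S

signProd-positive : ∀ {k} {f : Fin k → Sign} (S : Subset k) → PositiveOn f S → signProd f S ≡ plus
signProd-positive {zero}          []          pos = refl
signProd-positive {suc k} {f} (true  ∷ S) pos =
  cong₂ _·_ (pos here) (signProd-positive {f = f ∘ fsuc} S (pos ∘ there))
signProd-positive {suc k} {f} (false ∷ S) pos = signProd-positive {f = f ∘ fsuc} S (pos ∘ there)

signProd-single : ∀ {k} (f : Fin k → Sign) {S : Subset k} {a} → a ∈ S →
                  (∀ {e} → e ∈ S → e ≢ a → f e ≡ plus) → signProd f S ≡ f a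
signProd-single f {S} {a} a∈S others = begin
  signProd f S                                            ≡⟨ signProd≡∑ f S ⟩
  SignΣ.sum (λ e → if does (e ∈? S) then f e else plus)  ≡⟨ SignΣ.sum-cong-≗ onlyAt-a ⟩
  SignΣ.sum (λ e → if does (e ≟ a) then f e else plus)   ≡⟨ sum-pick ·-commutativeMonoid a f ⟩
  f a                                                     ∎
  where
    open ≡-Reasoning
    onlyAt-a : ∀ e → (if does (e ∈? S) then f e else plus) ≡ (if does (e ≟ a) then f e else plus)
    onlyAt-a e with e ≟ a | e ∈? S
    ... | yes refl | yes _   = refl
    ... | yes refl | no a∉S  = ⊥-elim (a∉S a∈S)
    ... | no e≢a   | yes e∈S = others e∈S e≢a
    ... | no _     | no _    = refl

×-even : ∀ k s → (k + k) ×ₛ s ≡ plus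
×-even k s = ≡.trans (×-homo-+ s k k) (·-selfInverse (k ×ₛ s))
  where open Mult (CommutativeMonoid.monoid ·-commutativeMonoid) using (×-homo-+)

module Switching {n : ℕ} (G : Graph n) (σ : Fin (Graph.m G) → Sign) where
  open Graph G
  open Incidence G

  switched : (Fin n → Sign) → Fin m → Sign
  switched τ e = σ e · (τ (end₁ e) · τ (end₂ e))

  switched-· : ∀ (τ ρ : Fin n → Sign) e →
               switched (λ w → τ w · ρ w) e ≡ switched τ e · (ρ (end₁ e) · ρ (end₂ e))
  switched-· τ ρ e = ≡.trans (cong (σ e ·_) (·-interchange (τ (end₁ e)) (ρ (end₁ e)) _ _))
                             (≡.sym (·-assoc (σ e) _ _))

  -- each vertex v contributes τ v once per edge of S at v, that is degIn G S v times
  signProd-endpoints : ∀ {S} → EvenDegrees S → (τ : Fin n → Sign) →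
                       signProd (λ e → τ (end₁ e) · τ (end₂ e)) S ≡ plus
  signProd-endpoints {S} even τ = begin
    signProd (λ e → τ (end₁ e) · τ (end₂ e)) S
      ≡⟨ signProd≡∑ _ S ⟩
    SignΣ.sum (λ e → if does (e ∈? S) then τ (end₁ e) · τ (end₂ e) else plus)
      ≡⟨ SignΣ.sum-cong-≗ {m} overEndpoints ⟨
    SignΣ.sum (λ e → SignΣ.sum (λ v → term e v))
      ≡⟨ SignΣ.∑-comm term ⟩
    SignΣ.sum (λ v → SignΣ.sum (λ e → term e v))
      ≡⟨ SignΣ.sum-cong-≗ {n} powerOfDegree ⟩
    SignΣ.sum (λ (_ : Fin n) → plus)
      ≡⟨ SignΣ.sum-replicate-zero n ⟩
    plus
      ∎
    where
      open ≡-Reasoning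
      term : Fin m → Fin n → Sign
      term e v = if does (e ∈? S) ∧ does (incident? G e v) then τ v else plus
      overEndpoints : ∀ e → SignΣ.sum (term e) ≡ (if does (e ∈? S) then τ (end₁ e) · τ (end₂ e) else plus)
      overEndpoints e with does (e ∈? S)
      ... | false = SignΣ.sum-replicate-zero n
      ... | true  = ≡.trans (SignΣ.sum-cong-≗ {n} λ v → cong (if_then τ v else plus) (incident-does e v))
                            (sum-pickPair ·-commutativeMonoid (loopless e) τ)
      powerOfDegree : ∀ v → SignΣ.sum (λ e → term e v) ≡ plus
      powerOfDegree v with even v
      ... | k , deg≡k+k = begin
        SignΣ.sum (λ e → term e v)
          ≡⟨ sum-countWhere ·-commutativeMonoid (λ e → does (e ∈? S) ∧ does (incident? G e v)) (τ v) ⟩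
        countWhere (λ e → does (e ∈? S) ∧ does (incident? G e v)) ×ₛ τ v
          ≡⟨ cong (_×ₛ τ v) (≡.trans (≡.sym (degIn-does S v)) deg≡k+k) ⟩
        (k + k) ×ₛ τ v
          ≡⟨ ×-even k (τ v) ⟩
        plus
          ∎

  signProd-switched : ∀ {S} → EvenDegrees S → (τ : Fin n → Sign) → signProd (switched τ) S ≡ signProd σ S
  signProd-switched {S} even τ = begin
    signProd (switched τ) S
      ≡⟨ signProd-· σ (λ e → τ (end₁ e) · τ (end₂ e)) S ⟩
    signProd σ S · signProd (λ e → τ (end₁ e) · τ (end₂ e)) S
      ≡⟨ cong (signProd σ S ·_) (signProd-endpoints even τ) ⟩
    signProd σ S · plus
      ≡⟨ ·-identityʳ _ ⟩
    signProd σ S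
      ∎
    where open ≡-Reasoning

  switchable⇒balanced : ∀ {K} (τ : Fin n → Sign) → PositiveOn (switched τ) K → BalancedOn G σ K
  switchable⇒balanced τ pos S S⊆K circle =
    ≡.trans (≡.sym (signProd-switched (isCircle⇒evenDegrees circle) τ))
            (signProd-positive S (pos ∘ S⊆K))

module Paths {n : ℕ} (G : Graph n) where
  open Graph G
  open Incidence G

  Joins-sym : ∀ {e a b} → Joins G e a b → Joins G e b a
  Joins-sym (inj₁ ends≡) = inj₂ ends≡
  Joins-sym (inj₂ ends≡) = inj₁ ends≡

  start-endpoint : ∀ {e u w} → Joins G e u w → (end₁ e ≡ u) ⊎ (end₂ e ≡ u)
  start-endpoint (inj₁ refl) = inj₁ refl
  start-endpoint (inj₂ refl) = inj₂ refl

  data Path : Fin n → Fin n → Set where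
    []   : ∀ {u} → Path u u
    step : ∀ {u w v} (e : Fin m) → Joins G e u w → Path w v → Path u v

  vertices : ∀ {u v} → Path u v → List (Fin n)
  vertices {u} []           = u ∷ []
  vertices {u} (step _ _ P) = u ∷ vertices P

  edges : ∀ {u v} → Path u v → List (Fin m)
  edges []           = []
  edges (step e _ P) = e ∷ edges P

  Simple : ∀ {u v} → Path u v → Set
  Simple P = Unique (vertices P)

  SimplePathWithin : (Fin m → Set) → Fin n → Fin n → Set
  SimplePathWithin A x y = Σ (Path x y) λ P → Simple P × All A (edges P)

  join : ∀ {x a b y} → Path x a → (e : Fin m) → Joins G e a b → Path b y → Path x y
  join []           e j Q = step e j Q
  join (step f i P) e j Q = step f i (join P e j Q)

  vertices-join : ∀ {x a b y} (P : Path x a) e (j : Joins G e a b) (Q : Path b y) →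
                  vertices (join P e j Q) ≡ vertices P ++ vertices Q
  vertices-join []           e j Q = refl
  vertices-join (step f i P) e j Q = cong (_ ∷_) (vertices-join P e j Q)

  edges-join : ∀ {x a b y} (P : Path x a) e (j : Joins G e a b) (Q : Path b y) →
               edges (join P e j Q) ≡ edges P ++ e ∷ edges Q
  edges-join []           e j Q = refl
  edges-join (step f i P) e j Q = cong (f ∷_) (edges-join P e j Q)

  start∈vertices : ∀ {u v} (P : Path u v) → u ∈ₗ vertices P
  start∈vertices []           = here refl
  start∈vertices (step _ _ _) = here refl

  endpoints∈vertices : ∀ {u v f} (P : Path u v) → f ∈ₗ edges P →
                       end₁ f ∈ₗ vertices P × end₂ f ∈ₗ vertices P
  endpoints∈vertices (step f (inj₁ refl) P) (here refl) = here refl , there (start∈vertices P)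
  endpoints∈vertices (step f (inj₂ refl) P) (here refl) = there (start∈vertices P) , here refl
  endpoints∈vertices (step e j P) (there f∈) =
    let (∈₁ , ∈₂) = endpoints∈vertices P f∈ in there ∈₁ , there ∈₂

  edges-unique : ∀ {u v} (P : Path u v) → Simple P → Unique (edges P)
  edges-unique []           _            = []
  edges-unique (step e j P) (u∉P ∷ uniq) =
    ¬Any⇒All¬ (edges P) startNotOnP ∷ edges-unique P uniq
    where
      startNotOnP : ¬ (e ∈ₗ edges P)
      startNotOnP e∈P with start-endpoint j
      ... | inj₁ refl = All¬⇒¬Any u∉P (proj₁ (endpoints∈vertices P e∈P))
      ... | inj₂ refl = All¬⇒¬Any u∉P (proj₂ (endpoints∈vertices P e∈P))

  join-simple : ∀ {x a b y} (P : Path x a) e (j : Joins G e a b) (Q : Path b y) →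
                Simple P → Simple Q → Disjoint (vertices P) (vertices Q) → Simple (join P e j Q)
  join-simple P e j Q simpleP simpleQ disjoint =
    subst Unique (≡.sym (vertices-join P e j Q)) (Unique.++⁺ simpleP simpleQ disjoint)

  join-all : ∀ {A : Fin m → Set} {x a b y} (P : Path x a) e (j : Joins G e a b) (Q : Path b y) →
             All A (edges P) → A e → All A (edges Q) → All A (edges (join P e j Q))
  join-all P e j Q allP Ae allQ = subst (All _) (≡.sym (edges-join P e j Q)) (All.++⁺ allP (Ae ∷ allQ))

  constant-on-path : ∀ {ℓ} {L : Set ℓ} {A : Fin m → Set} (c : Fin n → L) →
                     (∀ {f} → A f → c (end₁ f) ≡ c (end₂ f)) →
                     ∀ {a b x} (P : Path a b) → All A (edges P) → x ∈ₗ vertices P → c x ≡ c a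
  constant-on-path c along []           _           (here refl) = refl
  constant-on-path c along (step _ _ _) _           (here refl) = refl
  constant-on-path c along (step e j P) (Ae ∷ allP) (there x∈P) =
    ≡.trans (constant-on-path c along P allP x∈P) (edge-constant j)
    where
      edge-constant : ∀ {a w} → Joins G e a w → c w ≡ c a
      edge-constant (inj₁ refl) = ≡.sym (along Ae)
      edge-constant (inj₂ refl) = along Ae

  Reach-trans : ∀ {S x y z} → Reach G S x y → Reach G S y z → Reach G S x z
  Reach-trans here                r′ = r′
  Reach-trans (step e e∈S j r) r′ = step e e∈S j (Reach-trans r r′)

  reach-from-start : ∀ {S u v x} (P : Path u v) → All (_∈ S) (edges P) → x ∈ₗ vertices P → Reach G S u x
  reach-from-start []           _            (here refl) = here
  reach-from-start (step _ _ _) _            (here refl) = here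
  reach-from-start (step e j P) (e∈S ∷ P⊆S) (there x∈P) = step e e∈S j (reach-from-start P P⊆S x∈P)

  reach-to-start : ∀ {S u v x} (P : Path u v) → All (_∈ S) (edges P) → x ∈ₗ vertices P → Reach G S x u
  reach-to-start []           _            (here refl) = here
  reach-to-start (step _ _ _) _            (here refl) = here
  reach-to-start (step e j P) (e∈S ∷ P⊆S) (there x∈P) =
    Reach-trans (reach-to-start P P⊆S x∈P) (step e e∈S (Joins-sym j) here)

  reach-within : ∀ {S u v x y} (P : Path u v) → All (_∈ S) (edges P) →
                 x ∈ₗ vertices P → y ∈ₗ vertices P → Reach G S x y
  reach-within P P⊆S x∈P y∈P = Reach-trans (reach-to-start P P⊆S x∈P) (reach-from-start P P⊆S y∈P)

  incidence : Fin m → Fin n → ℕ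
  incidence f w = 𝟙 (does (incident? G f w))

  path-incidence : ∀ {a b} (P : Path a b) → Simple P → ∀ w →
                   sum (map (λ f → incidence f w) (edges P)) + (𝟙 (does (w ≟ a)) + 𝟙 (does (w ≟ b)))
                   ≡ 𝟙 (does (w ∈ₗ? vertices P)) + 𝟙 (does (w ∈ₗ? vertices P))
  path-incidence {a} [] _ w with w ≟ a
  ... | yes _ = refl
  ... | no _  = refl
  path-incidence {a} {b} (step {w = a′} e j P) (a∉P ∷ simple) w = begin
    (incidence e w + rest) + (δ a + δ b)   ≡⟨ cong (λ i → (i + rest) + (δ a + δ b)) (𝟙-incident j w) ⟩
    ((δ a + δ a′) + rest) + (δ a + δ b)    ≡⟨ solve 4 (λ x x′ r y → ((x :+ x′) :+ r) :+ (x :+ y)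
                                                                 := (x :+ x) :+ (r :+ (x′ :+ y)))
                                                       refl (δ a) (δ a′) rest (δ b) ⟩
    (δ a + δ a) + (rest + (δ a′ + δ b))    ≡⟨ cong ((δ a + δ a) +_) (path-incidence P simple w) ⟩
    (δ a + δ a) + (onP + onP)              ≡⟨ startOrRest ⟩
    𝟙 (does (w ≟ a) ∨ does (w ∈ₗ? vertices P)) + 𝟙 (does (w ≟ a) ∨ does (w ∈ₗ? vertices P)) ∎
    where
      open ≡-Reasoning
      open +-*-Solver
      δ : Fin n → ℕ
      δ x = 𝟙 (does (w ≟ x))
      rest onP : ℕ
      rest = sum (map (λ f → incidence f w) (edges P))
      onP = 𝟙 (does (w ∈ₗ? vertices P))
      startOrRest : (δ a + δ a) + (onP + onP)
                    ≡ 𝟙 (does (w ≟ a) ∨ does (w ∈ₗ? vertices P)) + 𝟙 (does (w ≟ a) ∨ does (w ∈ₗ? vertices P))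
      startOrRest with w ≟ a
      ... | yes refl rewrite dec-false (w ∈ₗ? vertices P) (All¬⇒¬Any a∉P) = refl
      ... | no _ = refl

  edgeSet : List (Fin m) → Subset m
  edgeSet L = tabulate (λ e → does (e ∈ₗ? L))

  edgeSet⁺ : ∀ L {e} → e ∈ₗ L → e ∈ edgeSet L
  edgeSet⁺ L {e} e∈L = ∈-tabulate⁺ (dec-true (e ∈ₗ? L) e∈L)

  edgeSet⁻ : ∀ L {e} → e ∈ edgeSet L → e ∈ₗ L
  edgeSet⁻ L {e} e∈S = invert (subst (Reflects (e ∈ₗ L)) (∈-tabulate⁻ e∈S) (proof (e ∈ₗ? L)))

  degIn-edgeSet : ∀ {L} → Unique L → ∀ w → degIn G (edgeSet L) w ≡ sum (map (λ f → incidence f w) L)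
  degIn-edgeSet {L} uniq w = begin
    degIn G (edgeSet L) w                                              ≡⟨ degIn-does (edgeSet L) w ⟩
    countWhere (λ e → does (e ∈? edgeSet L) ∧ does (incident? G e w))  ≡⟨ sumFin-cong restrict ⟩
    sumFin (λ e → if does (e ∈ₗ? L) then incidence e w else 0)         ≡⟨ sumFin-∈-Unique uniq _ ⟩
    sum (map (λ f → incidence f w) L)                                  ∎
    where
      open ≡-Reasoning
      restrict : ∀ e → 𝟙 (does (e ∈? edgeSet L) ∧ does (incident? G e w))
                       ≡ (if does (e ∈ₗ? L) then incidence e w else 0)
      restrict e rewrite does-∈?-tabulate (λ f → does (f ∈ₗ? L)) e with does (e ∈ₗ? L)
      ... | true  = refl
      ... | false = refl

  cycle-isCircle : ∀ {u v} (P : Path v u) → Simple P → (e : Fin m) → Joins G e u v →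
                   All (e ≢_) (edges P) → IsCircle G (edgeSet (e ∷ edges P))
  cycle-isCircle {u} {v} P simple e j e∉P = (e , edgeSet⁺ (e ∷ edges P) (here refl)) , zeroOrTwo , connected
    where
      open ≡-Reasoning
      S : Subset m
      S = edgeSet (e ∷ edges P)
      onP : Fin n → ℕ
      onP w = 𝟙 (does (w ∈ₗ? vertices P))
      δ : Fin n → Fin n → ℕ
      δ x w = 𝟙 (does (w ≟ x))
      degIn-S : ∀ w → degIn G S w ≡ onP w + onP w
      degIn-S w = begin
        degIn G S w                                 ≡⟨ degIn-edgeSet (e∉P ∷ edges-unique P simple) w ⟩
        incidence e w + rest                        ≡⟨ cong (_+ rest) (𝟙-incident j w) ⟩
        (δ u w + δ v w) + rest                      ≡⟨ +-comm (δ u w + δ v w) rest ⟩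
        rest + (δ u w + δ v w)                      ≡⟨ cong (rest +_) (+-comm (δ u w) (δ v w)) ⟩
        rest + (δ v w + δ u w)                      ≡⟨ path-incidence P simple w ⟩
        onP w + onP w                               ∎
        where
          rest : ℕ
          rest = sum (map (λ f → incidence f w) (edges P))
      zeroOrTwo : ∀ w → (degIn G S w ≡ 0) ⊎ (degIn G S w ≡ 2)
      zeroOrTwo w with does (w ∈ₗ? vertices P) | degIn-S w
      ... | false | d≡0 = inj₁ d≡0
      ... | true  | d≡2 = inj₂ d≡2
      onCycle : ∀ w → 0 < degIn G S w → w ∈ₗ vertices P
      onCycle w 0<d with w ∈ₗ? vertices P | degIn-S w
      ... | yes w∈P | _   = w∈P
      ... | no _    | d≡0 = ⊥-elim (<-irrefl (≡.sym d≡0) 0<d)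
      connected : ∀ x y → 0 < degIn G S x → 0 < degIn G S y → Reach G S x y
      connected x y 0<dx 0<dy =
        reach-within P (All.tabulate (λ f∈P → edgeSet⁺ (e ∷ edges P) (there f∈P)))
                       (onCycle x 0<dx) (onCycle y 0<dy)

module Harary {n : ℕ} (G : Graph n) (σ : Fin (Graph.m G) → Sign)
              {K : Subset (Graph.m G)} (balanced : BalancedOn G σ K) where
  open Graph G
  open Incidence G
  open Switching G σ
  open Paths G

  closing-edge-positive : ∀ {u v} (τ : Fin n → Sign) (P : Path v u) → Simple P →
                          (e : Fin m) → Joins G e u v → All (e ≢_) (edges P) →
                          e ∈ K → All (_∈ K) (edges P) → All (λ f → switched τ f ≡ plus) (edges P) →
                          switched τ e ≡ plus
  closing-edge-positive τ P simple e j e∉P e∈K P⊆K P-positive = begin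
    switched τ e             ≡⟨ signProd-single (switched τ) e∈S positiveOnP ⟨
    signProd (switched τ) S  ≡⟨ signProd-switched (isCircle⇒evenDegrees circle) τ ⟩
    signProd σ S             ≡⟨ balanced S S⊆K circle ⟩
    plus                     ∎
    where
      open ≡-Reasoning
      S : Subset m
      S = edgeSet (e ∷ edges P)
      circle : IsCircle G S
      circle = cycle-isCircle P simple e j e∉P
      e∈S : e ∈ S
      e∈S = edgeSet⁺ (e ∷ edges P) (here refl)
      S⊆K : S ⊆ K
      S⊆K f∈S with edgeSet⁻ (e ∷ edges P) f∈S
      ... | here refl = e∈K
      ... | there f∈P = All.lookup P⊆K f∈P
      positiveOnP : ∀ {f} → f ∈ S → f ≢ e → switched τ f ≡ plus
      positiveOnP f∈S f≢e with edgeSet⁻ (e ∷ edges P) f∈S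
      ... | here f≡e  = ⊥-elim (f≢e f≡e)
      ... | there f∈P = All.lookup P-positive f∈P

  Processed : ℕ → Fin m → Set
  Processed j e = e ∈ K × toℕ e < j

  -- the state after the edges of K with index below j have been added; `component`
  -- labels the connected components of the spanning subgraph they form
  record Stage (j : ℕ) : Set where
    field
      τ              : Fin n → Sign
      component      : Fin n → Fin n
      positive       : ∀ {e} → Processed j e → switched τ e ≡ plus
      component-edge : ∀ {e} → Processed j e → component (end₁ e) ≡ component (end₂ e)
      connect        : ∀ {x y} → component x ≡ component y → SimplePathWithin (Processed j) x y

  stage₀ : Stage 0
  stage₀ = record
    { τ = λ _ → plus ; component = λ x → x
    ; positive = λ () ; component-edge = λ ()
    ; connect = λ { refl → [] , (All.[] ∷ []) , [] } }

  module Step {j : ℕ} (j<m : j < m) where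
    new : Fin m
    new = fromℕ< j<m

    processed-mono : ∀ {e} → Processed j e → Processed (suc j) e
    processed-mono (e∈K , e<j) = e∈K , m<n⇒m<1+n e<j

    processed-new : new ∈ K → Processed (suc j) new
    processed-new new∈K = new∈K , s≤s (≤-reflexive (toℕ-fromℕ< j<m))

    processed-suc⁻ : ∀ {e} → Processed (suc j) e → Processed j e ⊎ e ≡ new
    processed-suc⁻ (e∈K , e<1+j) with m≤n⇒m<n∨m≡n (≤-pred e<1+j)
    ... | inj₁ e<j = inj₁ (e∈K , e<j)
    ... | inj₂ e≡j = inj₂ (toℕ-injective (≡.trans e≡j (≡.sym (toℕ-fromℕ< j<m))))

    new∉edges : ∀ {x y} (P : Path x y) → All (Processed j) (edges P) → All (new ≢_) (edges P)
    new∉edges P allP = All.map (λ { (_ , e<j) refl → <-irrefl (toℕ-fromℕ< j<m) e<j }) allP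

    processed-cases : ∀ {e} {A : Fin m → Set} → Processed (suc j) e →
                      (∀ {f} → Processed j f → A f) → (new ∈ K → A new) → A e
    processed-cases p old fresh with processed-suc⁻ p
    ... | inj₁ p′   = old p′
    ... | inj₂ refl = fresh (proj₁ p)

    within-suc : ∀ {x y} → SimplePathWithin (Processed j) x y → SimplePathWithin (Processed (suc j)) x y
    within-suc (P , simple , allP) = P , simple , All.map processed-mono allP

    keep : (I : Stage j) → let open Stage I in
           (new ∈ K → switched τ new ≡ plus × component (end₁ new) ≡ component (end₂ new)) → Stage (suc j)
    keep I new-ok = record
      { τ = τ ; component = component
      ; positive = λ p → processed-cases p positive (proj₁ ∘ new-ok)
      ; component-edge = λ p → processed-cases p component-edge (proj₂ ∘ new-ok)
      ; connect = within-suc ∘ connect }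
      where open Stage I

    bridge : (I : Stage j) → let open Stage I in
             ∀ {x a b y} e → Joins G e a b → Processed (suc j) e → component a ≢ component b →
             component x ≡ component a → component b ≡ component y →
             SimplePathWithin (Processed (suc j)) x y
    bridge I {x} {a} {b} e e-joins e-processed a≢b x∼a b∼y with Stage.connect I x∼a | Stage.connect I b∼y
    ... | P , simpleP , allP | Q , simpleQ , allQ =
        join P e e-joins Q
      , join-simple P e e-joins Q simpleP simpleQ disjoint
      , join-all P e e-joins Q (All.map processed-mono allP) e-processed (All.map processed-mono allQ)
      where
        open Stage I
        disjoint : Disjoint (vertices P) (vertices Q)
        disjoint {w} (w∈P , w∈Q) = a≢b (begin
          component a ≡⟨ x∼a ⟨
          component x ≡⟨ constant-on-path component component-edge P allP w∈P ⟨
          component w ≡⟨ constant-on-path component component-edge Q allQ w∈Q ⟩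
          component b ∎)
          where open ≡-Reasoning

    -- switching the whole component of v by s makes the new edge positive and leaves
    -- the edges inside components unchanged
    merge : (I : Stage j) → let open Stage I in
            new ∈ K → component (end₁ new) ≢ component (end₂ new) → Stage (suc j)
    merge I new∈K u≁v = record
      { τ = τ′ ; component = component′
      ; positive = λ p → processed-cases p old-positive (λ _ → new-positive)
      ; component-edge = λ p → processed-cases p (cong relabel ∘ component-edge) (λ _ → new-component-edge)
      ; connect = connect′ }
      where
        open Stage I
        open ≡-Reasoning
        u v : Fin n
        u = end₁ new
        v = end₂ new
        s : Sign
        s = switched τ new
        onV : Fin n → Bool
        onV l = does (l ≟ component v)
        ρ̂ ρ : Fin n → Sign
        ρ̂ l = if onV l then s else plus
        ρ w = ρ̂ (component w)
        τ′ : Fin n → Sign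
        τ′ w = τ w · ρ w
        relabel : Fin n → Fin n
        relabel l = if onV l then component u else l
        component′ : Fin n → Fin n
        component′ w = relabel (component w)

        onV-u : onV (component u) ≡ false
        onV-u = dec-false (component u ≟ component v) u≁v
        onV-v : onV (component v) ≡ true
        onV-v = dec-true (component v ≟ component v) refl

        old-positive : ∀ {f} → Processed j f → switched τ′ f ≡ plus
        old-positive {f} p = begin
          switched τ′ f                                ≡⟨ switched-· τ ρ f ⟩
          switched τ f · (ρ (end₁ f) · ρ (end₂ f))     ≡⟨ cong₂ (λ a b → a · (b · ρ (end₂ f)))
                                                                (positive p)
                                                                (cong ρ̂ (component-edge p)) ⟩
          plus · (ρ (end₂ f) · ρ (end₂ f))             ≡⟨ ·-selfInverse (ρ (end₂ f)) ⟩
          plus                                         ∎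

        new-positive : switched τ′ new ≡ plus
        new-positive = begin
          switched τ′ new                              ≡⟨ switched-· τ ρ new ⟩
          s · (ρ u · ρ v)                              ≡⟨ cong₂ (λ a b → s · (a · b))
                                                              (cong (if_then s else plus) onV-u)
                                                              (cong (if_then s else plus) onV-v) ⟩
          s · s                                        ≡⟨ ·-selfInverse s ⟩
          plus                                         ∎

        new-component-edge : component′ u ≡ component′ v
        new-component-edge = ≡.trans (cong (if_then component u else component u) onV-u)
                                     (≡.sym (cong (if_then component u else component v) onV-v))

        connect′ : ∀ {x y} → component′ x ≡ component′ y → SimplePathWithin (Processed (suc j)) x y
        connect′ {x} {y} x∼′y with component x ≟ component v | component y ≟ component v
        ... | yes x∼v | yes y∼v = within-suc (connect (≡.trans x∼v (≡.sym y∼v)))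
        ... | no _    | no _    = within-suc (connect x∼′y)
        ... | yes x∼v | no _    = bridge I new (inj₂ refl) (processed-new new∈K) (u≁v ∘ ≡.sym) x∼v x∼′y
        ... | no _    | yes y∼v = bridge I new (inj₁ refl) (processed-new new∈K) u≁v x∼′y (≡.sym y∼v)

    stage-suc : Stage j → Stage (suc j)
    stage-suc I with new ∈? K
    ... | no new∉K = keep I (λ new∈K → ⊥-elim (new∉K new∈K))
    ... | yes new∈K with Stage.component I (end₁ new) ≟ Stage.component I (end₂ new)
    ...   | no u≁v  = merge I new∈K u≁v
    ...   | yes u∼v with Stage.connect I (≡.sym u∼v)
    ...     | P , simple , allP = keep I λ _ →
                closing-edge-positive (Stage.τ I) P simple new (inj₁ refl) (new∉edges P allP)
                                      new∈K (All.map proj₁ allP) (All.map (Stage.positive I) allP)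
              , u∼v

  stage : ∀ j → j ≤ m → Stage j
  stage zero    _   = stage₀
  stage (suc j) j<m = Step.stage-suc j<m (stage j (<⇒≤ j<m))

  switchable : ∃ λ τ → PositiveOn (switched τ) K
  switchable = τ , λ e∈K → positive (e∈K , toℕ<n _)
    where open Stage (stage m ≤-refl)

halve-≤ : ∀ {k d} → k + k ≤ d → k ≤ ⌊ d /2⌋
halve-≤ {k} k+k≤d = subst (_≤ _) (≡.sym (n≡⌊n+n/2⌋ k)) (⌊n/2⌋-mono k+k≤d)

halfDegreeSum : ∀ {n} → Graph n → Subset n → ℕ
halfDegreeSum G X = sumFin (λ x → if does (x ∈? X) then ⌊ degree G x /2⌋ else 0)

module LocalSwitching {n : ℕ} (G : Graph n) (σ : Fin (Graph.m G) → Sign) (X : Subset n) where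
  open Graph G
  open Incidence G
  open Switching G σ

  frustrated : (Fin n → Sign) → Fin m → Bool
  frustrated τ e = isMinus (switched τ e)

  frustration : (Fin n → Sign) → ℕ
  frustration τ = countWhere (frustrated τ)

  frustrationAt : (Fin n → Sign) → Fin n → ℕ
  frustrationAt τ x = countWhere (λ e → frustrated τ e ∧ does (incident? G e x))

  negateAt : Fin n → Fin n → Sign
  negateAt x w = if does (w ≟ x) then minus else plus

  switchAt : Fin n → (Fin n → Sign) → Fin n → Sign
  switchAt x τ w = τ w · negateAt x w

  isMinus-negateAt : ∀ x {a b} → a ≢ b → isMinus (negateAt x a · negateAt x b) ≡ does (a ≟ x) ∨ does (b ≟ x)
  isMinus-negateAt x {a} {b} a≢b with a ≟ x | b ≟ x
  ... | yes refl | yes refl = ⊥-elim (a≢b refl)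
  ... | yes _    | no _     = refl
  ... | no _     | yes _    = refl
  ... | no _     | no _     = refl

  frustrated-switchAt : ∀ x τ e → frustrated (switchAt x τ) e ≡ frustrated τ e xor does (incident? G e x)
  frustrated-switchAt x τ e = begin
    isMinus (switched (switchAt x τ) e)
      ≡⟨ cong isMinus (switched-· τ (negateAt x) e) ⟩
    isMinus (switched τ e · (negateAt x (end₁ e) · negateAt x (end₂ e)))
      ≡⟨ isMinus-· (switched τ e) _ ⟩
    frustrated τ e xor isMinus (negateAt x (end₁ e) · negateAt x (end₂ e))
      ≡⟨ cong (frustrated τ e xor_) (isMinus-negateAt x (loopless e)) ⟩
    frustrated τ e xor does (incident? G e x)
      ∎
    where open ≡-Reasoning

  frustration-switchAt : ∀ x τ → frustration (switchAt x τ) + (frustrationAt τ x + frustrationAt τ x)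
                                 ≡ frustration τ + degree G x
  frustration-switchAt x τ = begin
    frustration (switchAt x τ) + (frustrationAt τ x + frustrationAt τ x)
      ≡⟨ cong (_+ (frustrationAt τ x + frustrationAt τ x))
              (sumFin-cong (cong 𝟙 ∘ frustrated-switchAt x τ)) ⟩
    countWhere (λ e → frustrated τ e xor does (incident? G e x)) + (frustrationAt τ x + frustrationAt τ x)
      ≡⟨ countWhere-xor (frustrated τ) (λ e → does (incident? G e x)) ⟩
    frustration τ + countWhere (λ e → does (incident? G e x))
      ≡⟨ cong (frustration τ +_) (degree-does x) ⟨
    frustration τ + degree G x
      ∎
    where open ≡-Reasoning

  PositiveOutside : (Fin n → Sign) → Set
  PositiveOutside τ = PositiveOn (switched τ) (edgesAvoiding G X)

  LocallyOptimal : (Fin n → Sign) → Set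
  LocallyOptimal τ = ∀ x → x ∈ X → frustrationAt τ x + frustrationAt τ x ≤ degree G x

  edgesAvoiding⁻ : ∀ {e} → e ∈ edgesAvoiding G X → end₁ e ∉ X × end₂ e ∉ X
  edgesAvoiding⁻ {e} e∈ with end₁ e ∈? X | end₂ e ∈? X | ∈-tabulate⁻ e∈
  ... | no e₁∉X | no e₂∉X | _ = e₁∉X , e₂∉X
  ... | yes _   | _       | ()
  ... | no _    | yes _   | ()

  edgesAvoiding⁺ : ∀ {e} → end₁ e ∉ X → end₂ e ∉ X → e ∈ edgesAvoiding G X
  edgesAvoiding⁺ {e} e₁∉X e₂∉X =
    ∈-tabulate⁺ (cong₂ (λ a b → not a ∧ not b) (isYes-false e₁∉X) (isYes-false e₂∉X))
    where
      isYes-false : ∀ {x} → x ∉ X → ⌊ x ∈? X ⌋ ≡ false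
      isYes-false {x} x∉X = ≡.trans (isYes≗does (x ∈? X)) (dec-false (x ∈? X) x∉X)

  switchAt-positiveOutside : ∀ {x} τ → x ∈ X → PositiveOutside τ → PositiveOutside (switchAt x τ)
  switchAt-positiveOutside {x} τ x∈X positive {e} e∈ with edgesAvoiding⁻ e∈
  ... | e₁∉X , e₂∉X = begin
    switched (switchAt x τ) e
      ≡⟨ switched-· τ (negateAt x) e ⟩
    switched τ e · (negateAt x (end₁ e) · negateAt x (end₂ e))
      ≡⟨ cong₂ (λ a b → switched τ e · (a · b)) (awayFromX e₁∉X) (awayFromX e₂∉X) ⟩
    switched τ e · plus
      ≡⟨ ·-identityʳ _ ⟩
    switched τ e
      ≡⟨ positive e∈ ⟩
    plus
      ∎
    where
      open ≡-Reasoning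
      awayFromX : ∀ {w} → w ∉ X → negateAt x w ≡ plus
      awayFromX {w} w∉X = cong (if_then minus else plus) (dec-false (w ≟ x) λ { refl → w∉X x∈X })

  -- k is fuel: each switch strictly lowers the frustration (frustration-switchAt)
  descend : ∀ k τ → frustration τ < k → PositiveOutside τ → ∃ λ τ′ → PositiveOutside τ′ × LocallyOptimal τ′
  descend zero    τ ()
  descend (suc k) τ f<1+k positive
    with any? (λ x → (x ∈? X) ×-dec (degree G x <? frustrationAt τ x + frustrationAt τ x))
  ... | yes (x , x∈X , d<2f) = descend k (switchAt x τ) decreased (switchAt-positiveOutside τ x∈X positive)
    where
      decreased : frustration (switchAt x τ) < k
      decreased = <-≤-trans
        (+-cancelʳ-< _ _ _ (subst (_< frustration τ + (frustrationAt τ x + frustrationAt τ x))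
                                  (≡.sym (frustration-switchAt x τ))
                                  (+-monoʳ-< (frustration τ) d<2f)))
        (≤-pred f<1+k)
  ... | no noneWorse = τ , positive , λ x x∈X → ≮⇒≥ (λ d<2f → noneWorse (x , x∈X , d<2f))

  frustrated⇒touches : ∀ τ {e} → PositiveOutside τ → frustrated τ e ≡ true →
                       ∃ λ x → x ∈ X × does (incident? G e x) ≡ true
  frustrated⇒touches τ {e} positive fr with end₁ e ∈? X | end₂ e ∈? X
  ... | yes e₁∈X | _        = end₁ e , e₁∈X , dec-true (incident? G e (end₁ e)) (inj₁ refl)
  ... | no _     | yes e₂∈X = end₂ e , e₂∈X , dec-true (incident? G e (end₂ e)) (inj₂ refl)
  ... | no e₁∉X  | no e₂∉X
    with () ← ≡.trans (≡.sym fr) (cong isMinus (positive (edgesAvoiding⁺ e₁∉X e₂∉X)))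

  frustration-bound : ∀ τ → PositiveOutside τ → LocallyOptimal τ →
                      frustration τ ≤ halfDegreeSum G X
  frustration-bound τ positive optimal = begin
    frustration τ
      ≤⟨ sumFin-mono counted ⟩
    sumFin (λ e → sumFin (λ x → 𝟙 (does (x ∈? X) ∧ atX e x)))
      ≡⟨ sumFin-comm (λ e x → 𝟙 (does (x ∈? X) ∧ atX e x)) ⟩
    sumFin (λ x → countWhere (λ e → does (x ∈? X) ∧ atX e x))
      ≡⟨ sumFin-cong (λ x → countWhere-∧ˡ (does (x ∈? X)) (λ e → atX e x)) ⟩
    sumFin (λ x → if does (x ∈? X) then frustrationAt τ x else 0)
      ≤⟨ sumFin-mono halve ⟩
    halfDegreeSum G X
      ∎
    where
      open ≤-Reasoning
      atX : Fin m → Fin n → Bool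
      atX e x = frustrated τ e ∧ does (incident? G e x)
      counted : ∀ e → 𝟙 (frustrated τ e) ≤ sumFin (λ x → 𝟙 (does (x ∈? X) ∧ atX e x))
      counted e with frustrated τ e in fr
      ... | false = z≤n
      ... | true with frustrated⇒touches τ positive fr
      ...   | x , x∈X , incident =
        ≤-trans (≤-reflexive (≡.sym termIsOne))
                (term≤sumFin (λ y → 𝟙 (does (y ∈? X) ∧ does (incident? G e y))) x)
        where
          termIsOne : 𝟙 (does (x ∈? X) ∧ does (incident? G e x)) ≡ 1
          termIsOne rewrite dec-true (x ∈? X) x∈X | incident = refl
      halve : ∀ x → (if does (x ∈? X) then frustrationAt τ x else 0)
                    ≤ (if does (x ∈? X) then ⌊ degree G x /2⌋ else 0)
      halve x with x ∈? X
      ... | yes x∈X = halve-≤ (optimal x x∈X)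
      ... | no _    = z≤n

  switching-with-bounded-frustration : BalancedAfterVertexDeletion G σ X →
    ∃ λ τ → frustration τ ≤ halfDegreeSum G X
  switching-with-bounded-frustration balanced-X with Harary.switchable G σ balanced-X
  ... | τ₀ , positive₀ with descend (suc (frustration τ₀)) τ₀ (n<1+n _) positive₀
  ...   | τ , positive , optimal = τ , frustration-bound τ positive optimal

  deleting-frustrated-balances : ∀ τ → BalancedAfterEdgeDeletion G σ (tabulate (frustrated τ))
  deleting-frustrated-balances τ =
    switchable⇒balanced τ λ e∈∁D → isMinus≡false (∉-tabulate⁻ (x∈∁p⇒x∉p e∈∁D))

prefixSum : ∀ {k} → (Fin k → ℕ) → ℕ → ℕ
prefixSum f t = sumFin (λ i → if toℕ i <ᵇ t then f i else 0)

NonIncreasing : ∀ {k} → (Fin k → ℕ) → Set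
NonIncreasing f = ∀ i j → toℕ i ≤ toℕ j → f j ≤ f i

NonIncreasing-tail : ∀ {k} {f : Fin (suc k) → ℕ} → NonIncreasing f → NonIncreasing (f ∘ fsuc)
NonIncreasing-tail mono i j = mono (fsuc i) (fsuc j) ∘ s≤s

prefixSum-tail≤ : ∀ {k} (f : Fin (suc k) → ℕ) → NonIncreasing f →
                  ∀ t → prefixSum (f ∘ fsuc) t ≤ prefixSum f t
prefixSum-tail≤ {k}     f mono zero    = ≤-trans (≤-reflexive (sumFin-zero k)) z≤n
prefixSum-tail≤ {zero}  f mono (suc t) = z≤n
prefixSum-tail≤ {suc k} f mono (suc t) =
  +-mono-≤ (mono fzero (fsuc fzero) z≤n) (prefixSum-tail≤ (f ∘ fsuc) (NonIncreasing-tail mono) t)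

subsetSum≤prefixSum : ∀ {k} (f : Fin k → ℕ) → NonIncreasing f → (Y : Fin k → Bool) →
                      sumFin (λ i → if Y i then f i else 0) ≤ prefixSum f (countWhere Y)
subsetSum≤prefixSum {zero}  f mono Y = z≤n
subsetSum≤prefixSum {suc k} f mono Y with Y fzero
... | true  = +-monoʳ-≤ (f fzero) (subsetSum≤prefixSum (f ∘ fsuc) (NonIncreasing-tail mono) (Y ∘ fsuc))
... | false = ≤-trans (subsetSum≤prefixSum (f ∘ fsuc) (NonIncreasing-tail mono) (Y ∘ fsuc))
                      (prefixSum-tail≤ f mono (countWhere (Y ∘ fsuc)))

frustrationIndex≤halfDegreeSum : ∀ {n} (G : Graph n) (σ : Fin (Graph.m G) → Sign) {l} {X : Subset n} →
  IsFrustrationIndex G σ l → BalancedAfterVertexDeletion G σ X → l ≤ halfDegreeSum G X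
frustrationIndex≤halfDegreeSum G σ {l} {X} (_ , minimal) balanced-X
  with LocalSwitching.switching-with-bounded-frustration G σ X balanced-X
... | τ , bound = begin
  l                  ≤⟨ minimal D (deleting-frustrated-balances τ) ⟩
  ∣ D ∣              ≡⟨ ∣tabulate∣ (frustrated τ) ⟩
  frustration τ      ≤⟨ bound ⟩
  halfDegreeSum G X  ∎
  where
    open ≤-Reasoning
    open LocalSwitching G σ X
    D : Subset (Graph.m G)
    D = tabulate (frustrated τ)

halfDegreeSum≤topHalfDegreeSum : ∀ {n} (G : Graph n) (π : Fin n ↔ Fin n) → DegreeSorted G (Inverse.to π) →
  (X : Subset n) → halfDegreeSum G X ≤ topHalfDegreeSum G (Inverse.to π) ∣ X ∣
halfDegreeSum≤topHalfDegreeSum {n} G π sorted X = begin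
  sumFin (λ x → if does (x ∈? X) then h x else 0)
    ≡⟨ sumFin-permute (λ x → if does (x ∈? X) then h x else 0) π ⟩
  sumFin (λ i → if does (to i ∈? X) then h (to i) else 0)
    ≤⟨ subsetSum≤prefixSum (h ∘ to) h∘to-nonincreasing (λ i → does (to i ∈? X)) ⟩
  prefixSum (h ∘ to) (countWhere (λ i → does (to i ∈? X)))
    ≡⟨ cong (prefixSum (h ∘ to)) count≡∣X∣ ⟩
  prefixSum (h ∘ to) ∣ X ∣
    ∎
  where
    open ≤-Reasoning
    to : Fin n → Fin n
    to = Inverse.to π
    h : Fin n → ℕ
    h x = ⌊ degree G x /2⌋
    h∘to-nonincreasing : NonIncreasing (h ∘ to)
    h∘to-nonincreasing i j i≤j = ⌊n/2⌋-mono (sorted i j i≤j)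
    count≡∣X∣ : countWhere (λ i → does (to i ∈? X)) ≡ ∣ X ∣
    count≡∣X∣ = ≡.sym (≡.trans (∣p∣≡countWhere-∈ X) (sumFin-permute (λ x → 𝟙 (does (x ∈? X))) π))

proposition2 : ∀ {n : ℕ} (G : Graph n) (σ : Fin (Graph.m G) → Sign)
                 (π : Fin n ↔ Fin n) → DegreeSorted G (Inverse.to π)
                 → ∀ (l l₀ : ℕ) → IsFrustrationIndex G σ l → IsFrustrationNumber G σ l₀
                 → l ≤ topHalfDegreeSum G (Inverse.to π) l₀
proposition2 G σ π sorted l l₀ index ((X , ∣X∣≡l₀ , balanced-X) , _) = begin
  l                                        ≤⟨ frustrationIndex≤halfDegreeSum G σ index balanced-X ⟩
  halfDegreeSum G X                        ≤⟨ halfDegreeSum≤topHalfDegreeSum G π sorted X ⟩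
  topHalfDegreeSum G (Inverse.to π) ∣ X ∣  ≡⟨ cong (topHalfDegreeSum G (Inverse.to π)) ∣X∣≡l₀ ⟩
  topHalfDegreeSum G (Inverse.to π) l₀     ∎
  where open ≤-Reasoning
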